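{- For $J\subseteq[n]$ let $\rho_J$ be the ring automorphism of $\mathbb{C}[p_I : I\subseteq[n]]$ sending $p_I\mapsto p_{I\Delta J}$, where $I\Delta J=(I\setminus J)\cup(J\setminus I)$. Regard the cumulants $k_I$ as polynomial functions of the $p_I$ on the hyperplane $\sum_Ip_I=1$. Then for all $I,J\subseteq[n]$ with $|I|\ge2$, $$\rho_J(k_I)=\begin{cases}-k_I & \text{if } |J\cap I| \text{ is odd},\\ \ \ k_I&\text{otherwise,}\end{cases}$$ and for each $i\in[n]$, $$\rho_J(k_i)=\begin{cases}1-k_i&\text{if } i\in J,\\ \ \ k_i&\text{otherwise.}\end{cases}$$
   Context: For a table $P=(p_I)_{I\subseteq[n]}$ with $\sum_Ip_I=1$: moments $\mu_I=\sum_{J\supseteq I}p_J$; cumulants $k_I=\sum_{\pi\in\Pi(I)}(-1)^{|\pi|-1}(|\pi|-1)!\prod_{B\in\pi}\mu_B$, where $\Pi(I)$ is the set of set partitions of $I$ and $|\pi|$ the number of blocks (equivalently, the $k_I$ are the coefficients of $\log\sum_I\mu_I\prod_{i\in I}x_i$ modulo $\langle x_1^2,\ldots,x_n^2\rangle$). We write $k_i$ for $k_{\{i\}}$. -}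

module Defs where

open import Level using (Level)
open import Data.Nat using (ℕ; zero; suc)
open import Data.Bool using (Bool; true; false; if_then_else_)
open import Data.Vec using (Vec; []; _∷_)
open import Data.List using (List; []; _∷_; map; length; foldr)
open import Data.Fin.Subset using (Subset; _∩_; _∪_; _─_)
open import Data.Fin.Subset.Properties using (_⊆?_)
open import Relation.Nullary.Decidable using (does)
open import Algebra.Bundles using (CommutativeRing)

_Δ_ : ∀ {n} → Subset n → Subset n → Subset n
I Δ J = (I ─ J) ∪ (J ─ I)

-- Recursion on n: the partitions of  b ∷ I  are obtained from those of I
-- (blocks shifted by one); if b = true, element 0 is either added as a new
-- singleton block or inserted into exactly one existing block.
private
  shift : ∀ {n} → List (Subset n) → List (Subset (suc n))
  shift = map (false ∷_)

  singleton0 : ∀ {n} → Subset (suc n)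
  singleton0 {n} = true ∷ Data.Fin.Subset.⊥

  insertEach : ∀ {n} → List (Subset n) → List (List (Subset (suc n)))
  insertEach [] = []
  insertEach (B ∷ Bs) =
    ((true ∷ B) ∷ shift Bs) ∷ map ((false ∷ B) ∷_) (insertEach Bs)

  concatMap' : ∀ {a b} {A : Set a} {B : Set b} → (A → List B) → List A → List B
  concatMap' f = foldr (λ x acc → Data.List._++_ (f x) acc) []

setPartitions : ∀ {n} → Subset n → List (List (Subset n))
setPartitions [] = [] ∷ []
setPartitions (false ∷ I) = map shift (setPartitions I)
setPartitions (true ∷ I) =
  concatMap' (λ π → (singleton0 ∷ shift π) ∷ insertEach π) (setPartitions I)

module Cumulants {c ℓ : Level} (R : CommutativeRing c ℓ) where
  open CommutativeRing R

  sumSubsets : ∀ {n} → (Subset n → Carrier) → Carrier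
  sumSubsets {zero} f = f []
  sumSubsets {suc n} f =
    sumSubsets (λ s → f (false ∷ s)) + sumSubsets (λ s → f (true ∷ s))

  fromℕ : ℕ → Carrier
  fromℕ zero = 0#
  fromℕ (suc m) = 1# + fromℕ m

  fact : ℕ → Carrier
  fact zero = 1#
  fact (suc m) = fromℕ (suc m) * fact m

  sign : ℕ → Carrier
  sign zero = 1#
  sign (suc m) = - sign m

  coeff : ℕ → Carrier
  coeff zero = 0#     -- irrelevant: only occurs for I = ∅
  coeff (suc m) = sign m * fact m

  prod : List Carrier → Carrier
  prod = foldr _*_ 1#

  sumL : List Carrier → Carrier
  sumL = foldr _+_ 0#

  moment : ∀ {n} → (Subset n → Carrier) → Subset n → Carrier
  moment p I = sumSubsets (λ J → if does (I ⊆? J) then p J else 0#)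

  cumulant : ∀ {n} → (Subset n → Carrier) → Subset n → Carrier
  cumulant p I =
    sumL (map (λ π → coeff (length π) * prod (map (moment p) π)) (setPartitions I))

  -- ρ_J acting on points: (ρ_J f)(p) = f(p ∘ (_Δ J)), since ρ_J(p_I) = p_{I Δ J}
  ρ : ∀ {n} → Subset n → (Subset n → Carrier) → (Subset n → Carrier)
  ρ J p I = p (I Δ J)

module Submission where

-- Let μ′, k′ be the moments and cumulants of ρ_{j} p.  Summing p over the j-th coordinate
-- gives μ′_B = μ_B if j ∉ B and μ′_B + μ_B = μ_{B∖j} if j ∈ B, so k′_I = k_I when j ∉ I.
-- When j ∈ I, the sum k′_I + k_I replaces the weight of the block B ∋ j by μ_{B∖j}; grouping
-- the partitions of I by the partition σ of I ∖ {j} they induce (j forms a new block or joins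
-- one of the |σ| blocks) gives k′_I + k_I = Σ_σ c(|σ|) Π_{B ∈ σ} μ_B with
-- c(m) = (−1)^m m! + m (−1)^(m−1) (m−1)!.  As c(0) = 1 and c(m) = 0 for m ≥ 1, this yields
-- k′_I = −k_I for |I| ≥ 2 and k′_j = μ_∅ − k_j = 1 − k_j.  Finally ρ_J is the composite of the
-- ρ_{j} with j ∈ J, and these actions compose according to the parity of |J ∩ I|.

open import Defs
open import Level using (Level)
open import Data.Nat using (ℕ; _≤_; _%_)
open import Data.Product using (_×_)
open import Relation.Binary.PropositionalEquality using (_≡_)
open import Relation.Nullary using (¬_)
open import Data.Fin using (Fin)
open import Data.Fin.Subset using (Subset; ∣_∣; _∩_; _∈_; _∉_; ⁅_⁆)
open import Algebra.Bundles using (CommutativeRing)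
open import Algebra.Morphism.Structures using (IsRingHomomorphism)

open import Data.Nat using (zero; suc; s≤s; z≤n)
open import Data.Nat.Properties using (≤-trans)
open import Data.Nat.DivMod using (%-distribˡ-+)
open import Data.Bool using (Bool; true; false; not; _∧_; _xor_; if_then_else_)
open import Data.Bool.Properties
  using (xor-assoc; xor-identityʳ; ∧-distribʳ-xor; ∧-identityʳ; ∧-zeroʳ; xor-∧-commutativeRing)
open import Data.Fin.Subset.Properties using (_⊆?_; ⊥⊆; ∩-comm; x∈⁅x⁆; x∈⁅y⁆⇒x≡y)
open import Relation.Nullary.Decidable using (does; dec-true)
open import Relation.Nullary.Negation using (contradiction)
open import Data.Fin using (zero; suc)
open import Data.Fin.Subset using (⊥; Nonempty)
open import Data.List using (List; []; _∷_; map; length; foldr; _++_; concatMap)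
open import Data.List.Properties using (length-map; map-∘; map-++)
open import Data.Product using (_,_; proj₁; proj₂)
open import Data.Vec using ([]; _∷_; lookup; _[_]≔_; _[_]=_; here; there)
open import Data.Vec.Properties
  using (lookup⇒[]=; []=⇒lookup; lookup-replicate; []≔-idempotent; []≔-lookup; []≔-updates)
open import Function using (_∘_)
import Relation.Binary.PropositionalEquality as ≡

insertions : ∀ {n} → List (Subset n) → List (List (Subset (suc n)))
insertions [] = []
insertions (B ∷ Bs) =
  ((true ∷ B) ∷ map (false ∷_) Bs) ∷ map ((false ∷ B) ∷_) (insertions Bs)

-- `Defs` builds `setPartitions` from private copies of `concatMap` and `insertions`,
-- so they are recognised through their defining equations.
setPartitions-inside : ∀ {n} (I : Subset n) →
  setPartitions (true ∷ I)
    ≡ concatMap (λ π → ((true ∷ ⊥) ∷ map (false ∷_) π) ∷ insertions π) (setPartitions I)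
setPartitions-inside I = recognise _ _ ≡.refl (λ _ _ → ≡.refl) (λ _ → ≡.refl) (setPartitions I)
  where
  recognise : ∀ {n} (g ie : List (Subset n) → List (List (Subset (suc n)))) → ie [] ≡ [] →
    (∀ B Bs → ie (B ∷ Bs) ≡ ((true ∷ B) ∷ map (false ∷_) Bs) ∷ map ((false ∷ B) ∷_) (ie Bs)) →
    (∀ π → g π ≡ ((true ∷ ⊥) ∷ map (false ∷_) π) ∷ ie π) →
    ∀ πs → foldr (λ π acc → g π ++ acc) [] πs
             ≡ concatMap (λ π → ((true ∷ ⊥) ∷ map (false ∷_) π) ∷ insertions π) πs
  recognise g ie ie[] ie∷ g≡ = go
    where
    ie≡insertions : ∀ σ → ie σ ≡ insertions σ
    ie≡insertions [] = ie[]
    ie≡insertions (B ∷ Bs) =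
      ≡.trans (ie∷ B Bs) (≡.cong (λ τ → ((true ∷ B) ∷ map (false ∷_) Bs) ∷ map ((false ∷ B) ∷_) τ) (ie≡insertions Bs))
    go : ∀ πs → foldr (λ π acc → g π ++ acc) [] πs
                  ≡ concatMap (λ π → ((true ∷ ⊥) ∷ map (false ∷_) π) ∷ insertions π) πs
    go [] = ≡.refl
    go (π ∷ πs) =
      ≡.cong₂ _++_ (≡.trans (g≡ π) (≡.cong (((true ∷ ⊥) ∷ map (false ∷_) π) ∷_) (ie≡insertions π))) (go πs)

⊥-outside : ∀ {n} (j : Fin n) → ⊥ [ j ]= false
⊥-outside j = lookup⇒[]= j ⊥ (lookup-replicate j false)

remove-insert : ∀ {n} {B : Subset n} {j} → B [ j ]= false → (B [ j ]≔ true) [ j ]≔ false ≡ B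
remove-insert {B = B} {j} B∌j =
  ≡.trans ([]≔-idempotent B j) (≡.trans (≡.cong (B [ j ]≔_) (≡.sym ([]=⇒lookup B∌j))) ([]≔-lookup B j))

∷-Δ-∷ : ∀ {n} x y (K L : Subset n) → (x ∷ K) Δ (y ∷ L) ≡ (x xor y) ∷ (K Δ L)
∷-Δ-∷ false false K L = ≡.refl
∷-Δ-∷ false true  K L = ≡.refl
∷-Δ-∷ true  false K L = ≡.refl
∷-Δ-∷ true  true  K L = ≡.refl

Δ-identityʳ : ∀ {n} (K : Subset n) → K Δ ⊥ ≡ K
Δ-identityʳ [] = ≡.refl
Δ-identityʳ (x ∷ K) = ≡.trans (∷-Δ-∷ x false K ⊥) (≡.cong₂ _∷_ (xor-identityʳ x) (Δ-identityʳ K))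

Δ-assoc : ∀ {n} (K L M : Subset n) → (K Δ L) Δ M ≡ K Δ (L Δ M)
Δ-assoc [] [] [] = ≡.refl
Δ-assoc (x ∷ K) (y ∷ L) (z ∷ M) = begin
  ((x ∷ K) Δ (y ∷ L)) Δ (z ∷ M)        ≡⟨ ≡.cong (_Δ (z ∷ M)) (∷-Δ-∷ x y K L) ⟩
  ((x xor y) ∷ (K Δ L)) Δ (z ∷ M)      ≡⟨ ∷-Δ-∷ (x xor y) z (K Δ L) M ⟩
  ((x xor y) xor z) ∷ ((K Δ L) Δ M)    ≡⟨ ≡.cong₂ _∷_ (xor-assoc x y z) (Δ-assoc K L M) ⟩
  (x xor (y xor z)) ∷ (K Δ (L Δ M))    ≡⟨ ∷-Δ-∷ x (y xor z) K (L Δ M) ⟨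
  (x ∷ K) Δ ((y xor z) ∷ (L Δ M))      ≡⟨ ≡.cong ((x ∷ K) Δ_) (∷-Δ-∷ y z L M) ⟨
  (x ∷ K) Δ ((y ∷ L) Δ (z ∷ M))        ∎
  where open ≡.≡-Reasoning

Δ-induction : ∀ {a n} (P : Subset n → Set a) → P ⊥ → (∀ A j → P A → P (A Δ ⁅ j ⁆)) → ∀ J → P J
Δ-induction P P⊥ step [] = P⊥
Δ-induction P P⊥ step (false ∷ J) = Δ-induction (P ∘ (false ∷_)) P⊥ (λ A j → step (false ∷ A) (suc j)) J
Δ-induction P P⊥ step (true ∷ J) = ≡.subst P (≡.cong (true ∷_) (Δ-identityʳ J))
  (step (false ∷ J) zero (Δ-induction (P ∘ (false ∷_)) P⊥ (λ A j → step (false ∷ A) (suc j)) J))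

isOdd : ∀ {n} → Subset n → Bool
isOdd [] = false
isOdd (x ∷ p) = x xor isOdd p

∣p∣%2≡isOdd : ∀ {n} (p : Subset n) → ∣ p ∣ % 2 ≡ (if isOdd p then 1 else 0)
∣p∣%2≡isOdd [] = ≡.refl
∣p∣%2≡isOdd (false ∷ p) = ∣p∣%2≡isOdd p
∣p∣%2≡isOdd (true ∷ p) =
  ≡.trans (%-distribˡ-+ 1 ∣ p ∣ 2) (≡.trans (≡.cong (λ r → suc r % 2) (∣p∣%2≡isOdd p)) (parity-suc (isOdd p)))
  where
  parity-suc : ∀ b → suc (if b then 1 else 0) % 2 ≡ (if not b then 1 else 0)
  parity-suc false = ≡.refl
  parity-suc true = ≡.refl

isOdd-Δ-∩ : ∀ {n} (A B I : Subset n) → isOdd ((A Δ B) ∩ I) ≡ isOdd (A ∩ I) xor isOdd (B ∩ I)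
isOdd-Δ-∩ [] [] [] = ≡.refl
isOdd-Δ-∩ (a ∷ A) (b ∷ B) (y ∷ I) = begin
  isOdd (((a ∷ A) Δ (b ∷ B)) ∩ (y ∷ I))                ≡⟨ ≡.cong (λ X → isOdd (X ∩ (y ∷ I))) (∷-Δ-∷ a b A B) ⟩
  ((a xor b) ∧ y) xor isOdd ((A Δ B) ∩ I)              ≡⟨ ≡.cong₂ _xor_ (∧-distribʳ-xor y a b) (isOdd-Δ-∩ A B I) ⟩
  ((a ∧ y) xor (b ∧ y)) xor (isOdd (A ∩ I) xor isOdd (B ∩ I))
    ≡⟨ xor-interchange (a ∧ y) (b ∧ y) (isOdd (A ∩ I)) (isOdd (B ∩ I)) ⟩
  isOdd ((a ∷ A) ∩ (y ∷ I)) xor isOdd ((b ∷ B) ∩ (y ∷ I)) ∎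
  where
  open ≡.≡-Reasoning
  open import Algebra.Properties.CommutativeSemigroup (CommutativeRing.+-commutativeSemigroup xor-∧-commutativeRing)
    using () renaming (interchange to xor-interchange)

isOdd-⊥-∩ : ∀ {n} (I : Subset n) → isOdd (⊥ ∩ I) ≡ false
isOdd-⊥-∩ [] = ≡.refl
isOdd-⊥-∩ (y ∷ I) = isOdd-⊥-∩ I

isOdd-∩-⁅⁆ : ∀ {n} (J : Subset n) i → isOdd (J ∩ ⁅ i ⁆) ≡ lookup J i
isOdd-∩-⁅⁆ (x ∷ J) zero = ≡.trans (≡.cong (x ∧ true xor_) (isOdd-∩-⊥ J)) (≡.trans (xor-identityʳ _) (∧-identityʳ x))
  where
  isOdd-∩-⊥ : ∀ {n} (J : Subset n) → isOdd (J ∩ ⊥) ≡ false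
  isOdd-∩-⊥ J = ≡.trans (≡.cong isOdd (∩-comm J ⊥)) (isOdd-⊥-∩ J)
isOdd-∩-⁅⁆ (x ∷ J) (suc i) = ≡.trans (≡.cong (x ∧ false xor_) (isOdd-∩-⁅⁆ J i)) (≡.cong (_xor lookup J i) (∧-zeroʳ x))

nonempty : ∀ {n} (p : Subset n) → 1 ≤ ∣ p ∣ → Nonempty p
nonempty (true ∷ p) _ = zero , here
nonempty (false ∷ p) 1≤∣p∣ = let i , i∈p = nonempty p 1≤∣p∣ in suc i , there i∈p

remove-nonempty : ∀ {n} (I : Subset n) j → 2 ≤ ∣ I ∣ → Nonempty (I [ j ]≔ false)
remove-nonempty (true ∷ I) zero (s≤s 1≤∣I∣) = let i , i∈I = nonempty I 1≤∣I∣ in suc i , there i∈I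
remove-nonempty (false ∷ I) zero 2≤∣I∣ = nonempty (false ∷ I) (≤-trans (s≤s z≤n) 2≤∣I∣)
remove-nonempty (true ∷ I) (suc j) _ = zero , here
remove-nonempty (false ∷ I) (suc j) 2≤∣I∣ = let i , i∈ = remove-nonempty I j 2≤∣I∣ in suc i , there i∈

⁅i⁆-remove-i : ∀ {n} (i : Fin n) → ⁅ i ⁆ [ i ]≔ false ≡ ⊥
⁅i⁆-remove-i zero = ≡.refl
⁅i⁆-remove-i (suc i) = ≡.cong (false ∷_) (⁅i⁆-remove-i i)

isOdd-⁅⁆-∩ : ∀ {n} (j : Fin n) I → isOdd (⁅ j ⁆ ∩ I) ≡ lookup I j
isOdd-⁅⁆-∩ j I = ≡.trans (≡.cong isOdd (∩-comm ⁅ j ⁆ I)) (isOdd-∩-⁅⁆ I j)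

module PartitionSums {c ℓ : Level} (R : CommutativeRing c ℓ) where
  open CommutativeRing R
  open Cumulants R using (sumL; prod)
  open import Relation.Binary.Reasoning.Setoid setoid
  open import Algebra.Properties.CommutativeSemigroup +-commutativeSemigroup using (interchange)
  open import Algebra.Solver.Ring.NaturalCoefficients.Default commutativeSemiring using (solve; _:=_; _:+_; _:*_)

  private
    variable
      a : Level
      A B : Set a
      n : ℕ

  sumL-cong : ∀ {F G : A → Carrier} → (∀ x → F x ≈ G x) → ∀ xs → sumL (map F xs) ≈ sumL (map G xs)
  sumL-cong F≈G [] = refl
  sumL-cong F≈G (x ∷ xs) = +-cong (F≈G x) (sumL-cong F≈G xs)

  prod-cong : ∀ {F G : A → Carrier} → (∀ x → F x ≈ G x) → ∀ xs → prod (map F xs) ≈ prod (map G xs)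
  prod-cong F≈G [] = refl
  prod-cong F≈G (x ∷ xs) = *-cong (F≈G x) (prod-cong F≈G xs)

  sumL-zero : ∀ {F : A → Carrier} → (∀ x → F x ≈ 0#) → ∀ xs → sumL (map F xs) ≈ 0#
  sumL-zero F≈0 [] = refl
  sumL-zero F≈0 (x ∷ xs) = trans (+-cong (F≈0 x) (sumL-zero F≈0 xs)) (+-identityʳ 0#)

  sumL-+ : ∀ (F G : A → Carrier) xs → sumL (map F xs) + sumL (map G xs) ≈ sumL (map (λ x → F x + G x) xs)
  sumL-+ F G [] = +-identityʳ 0#
  sumL-+ F G (x ∷ xs) = trans (interchange _ _ _ _) (+-cong refl (sumL-+ F G xs))

  sumL-++ : ∀ xs ys → sumL (xs ++ ys) ≈ sumL xs + sumL ys
  sumL-++ [] ys = sym (+-identityˡ _)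
  sumL-++ (x ∷ xs) ys = trans (+-cong refl (sumL-++ xs ys)) (sym (+-assoc _ _ _))

  sumL-concatMap : ∀ (F : B → Carrier) (g : A → List B) xs →
    sumL (map F (concatMap g xs)) ≈ sumL (map (λ x → sumL (map F (g x))) xs)
  sumL-concatMap F g [] = refl
  sumL-concatMap F g (x ∷ xs) = begin
    sumL (map F (g x ++ concatMap g xs))          ≡⟨ ≡.cong sumL (map-++ F (g x) _) ⟩
    sumL (map F (g x) ++ map F (concatMap g xs))  ≈⟨ sumL-++ (map F (g x)) _ ⟩
    sumL (map F (g x)) + sumL (map F (concatMap g xs)) ≈⟨ +-cong refl (sumL-concatMap F g xs) ⟩
    sumL (map (λ x → sumL (map F (g x))) (x ∷ xs)) ∎

  sumL-map-map : ∀ (F : B → Carrier) (g : A → B) xs → sumL (map F (map g xs)) ≡ sumL (map (F ∘ g) xs)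
  sumL-map-map F g xs = ≡.cong sumL (≡.sym (map-∘ xs))

  prod-map-map : ∀ (F : B → Carrier) (g : A → B) xs → prod (map F (map g xs)) ≡ prod (map (F ∘ g) xs)
  prod-map-map F g xs = ≡.cong prod (≡.sym (map-∘ xs))

  partitionSum : (ℕ → Carrier) → (Subset n → Carrier) → Subset n → Carrier
  partitionSum H w I = sumL (map (λ π → H (length π) * prod (map w π)) (setPartitions I))

  -- The ε-coefficients of  Π_{B ∈ σ} (w B + ε w′ B)  and of  partitionSum (H + ε H′) (w + ε w′)
  -- over the dual numbers R[ε]/(ε²).
  prod′ : (w w′ : Subset n → Carrier) → List (Subset n) → Carrier
  prod′ w w′ [] = 0#
  prod′ w w′ (B ∷ σ) = w B * prod′ w w′ σ + w′ B * prod (map w σ)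

  partitionSum′ : (H H′ : ℕ → Carrier) (w w′ : Subset n → Carrier) → Subset n → Carrier
  partitionSum′ H H′ w w′ X =
    sumL (map (λ σ → H (length σ) * prod′ w w′ σ + H′ (length σ) * prod (map w σ)) (setPartitions X))

  partitionSum-cong : ∀ {H H′ : ℕ → Carrier} {w w′ : Subset n → Carrier} →
    (∀ m → H m ≈ H′ m) → (∀ B → w B ≈ w′ B) → ∀ I → partitionSum H w I ≈ partitionSum H′ w′ I
  partitionSum-cong H≈H′ w≈w′ I =
    sumL-cong (λ π → *-cong (H≈H′ _) (prod-cong w≈w′ π)) (setPartitions I)

  partitionSum-outside : ∀ (H : ℕ → Carrier) (w : Subset (suc n) → Carrier) X →
    partitionSum H w (false ∷ X) ≈ partitionSum H (w ∘ (false ∷_)) X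
  partitionSum-outside H w X = trans (reflexive (sumL-map-map _ _ (setPartitions X)))
    (sumL-cong (λ σ → reflexive (≡.cong₂ (λ m q → H m * q) (length-map _ σ) (prod-map-map w _ σ)))
               (setPartitions X))

  prod′-outside : ∀ (w w′ : Subset (suc n) → Carrier) σ →
    prod′ w w′ (map (false ∷_) σ) ≡ prod′ (w ∘ (false ∷_)) (w′ ∘ (false ∷_)) σ
  prod′-outside w w′ [] = ≡.refl
  prod′-outside w w′ (B ∷ σ) =
    ≡.cong₂ (λ d q → w (false ∷ B) * d + w′ (false ∷ B) * q) (prod′-outside w w′ σ) (prod-map-map w _ σ)

  partitionSum′-outside : ∀ (H H′ : ℕ → Carrier) (w w′ : Subset (suc n) → Carrier) X →
    partitionSum′ H H′ w w′ (false ∷ X) ≈ partitionSum′ H H′ (w ∘ (false ∷_)) (w′ ∘ (false ∷_)) X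
  partitionSum′-outside H H′ w w′ X = trans (reflexive (sumL-map-map _ _ (setPartitions X)))
    (sumL-cong (λ σ → reflexive (≡.cong₂ (λ m (d , q) → H m * d + H′ m * q) (length-map _ σ)
                                   (≡.cong₂ _,_ (prod′-outside w w′ σ) (prod-map-map w _ σ))))
               (setPartitions X))

  -- Putting the new element 0 into each block of σ in turn differentiates the product of the weights.
  sumL-insertions : ∀ (H : ℕ → Carrier) (w : Subset (suc n) → Carrier) σ →
    sumL (map (λ π → H (length π) * prod (map w π)) (insertions σ))
      ≈ H (length σ) * prod′ (w ∘ (false ∷_)) (w ∘ (true ∷_)) σ
  sumL-insertions H w [] = sym (zeroʳ _)
  sumL-insertions H w (B ∷ σ) = begin
    H (suc (length (map (false ∷_) σ))) * (w (true ∷ B) * prod (map w (map (false ∷_) σ)))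
      + sumL (map (λ π → H (length π) * prod (map w π)) (map ((false ∷ B) ∷_) (insertions σ)))
      ≈⟨ +-cong (reflexive (≡.cong₂ (λ m q → H (suc m) * (w (true ∷ B) * q)) (length-map _ σ) (prod-map-map w _ σ)))
                (reflexive (sumL-map-map _ _ (insertions σ))) ⟩
    H (suc (length σ)) * (w (true ∷ B) * q)
      + sumL (map (λ π → H (suc (length π)) * (w (false ∷ B) * prod (map w π))) (insertions σ))
      ≈⟨ +-cong refl (sumL-cong (λ π → sym (*-assoc _ _ _)) (insertions σ)) ⟩
    H (suc (length σ)) * (w (true ∷ B) * q)
      + sumL (map (λ π → H′ (length π) * prod (map w π)) (insertions σ))
      ≈⟨ +-cong refl (sumL-insertions H′ w σ) ⟩
    H (suc (length σ)) * (w (true ∷ B) * q) + H′ (length σ) * d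
      ≈⟨ solve 5 (λ h a q b d → h :* (a :* q) :+ (h :* b) :* d := h :* (b :* d :+ a :* q)) refl
               (H (suc (length σ))) (w (true ∷ B)) q (w (false ∷ B)) d ⟩
    H (suc (length σ)) * prod′ (w ∘ (false ∷_)) (w ∘ (true ∷_)) (B ∷ σ) ∎
    where
    q = prod (map (w ∘ (false ∷_)) σ)
    d = prod′ (w ∘ (false ∷_)) (w ∘ (true ∷_)) σ
    H′ : ℕ → Carrier
    H′ m = H (suc m) * w (false ∷ B)

  -- A partition of {0} ∪ X either has {0} as a block or arises by inserting 0 into a block.
  partitionSum-inside : ∀ (H : ℕ → Carrier) (w : Subset (suc n) → Carrier) X →
    partitionSum H w (true ∷ X)
      ≈ partitionSum′ H (λ m → w (true ∷ ⊥) * H (suc m)) (w ∘ (false ∷_)) (w ∘ (true ∷_)) X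
  partitionSum-inside H w X = begin
    partitionSum H w (true ∷ X)
      ≡⟨ ≡.cong (sumL ∘ map F) (setPartitions-inside X) ⟩
    sumL (map F (concatMap (λ π → ((true ∷ ⊥) ∷ map (false ∷_) π) ∷ insertions π) (setPartitions X)))
      ≈⟨ sumL-concatMap F _ (setPartitions X) ⟩
    sumL (map (λ σ → H (suc (length (map (false ∷_) σ))) * (w (true ∷ ⊥) * prod (map w (map (false ∷_) σ)))
                     + sumL (map F (insertions σ))) (setPartitions X))
      ≈⟨ sumL-cong split (setPartitions X) ⟩
    partitionSum′ H (λ m → w (true ∷ ⊥) * H (suc m)) (w ∘ (false ∷_)) (w ∘ (true ∷_)) X ∎
    where
    F : List (Subset (suc _)) → Carrier
    F π = H (length π) * prod (map w π)
    split : ∀ σ → H (suc (length (map (false ∷_) σ))) * (w (true ∷ ⊥) * prod (map w (map (false ∷_) σ)))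
                  + sumL (map F (insertions σ))
                ≈ H (length σ) * prod′ (w ∘ (false ∷_)) (w ∘ (true ∷_)) σ
                  + w (true ∷ ⊥) * H (suc (length σ)) * prod (map (w ∘ (false ∷_)) σ)
    split σ = begin
      H (suc (length (map (false ∷_) σ))) * (w (true ∷ ⊥) * prod (map w (map (false ∷_) σ)))
        + sumL (map F (insertions σ))
        ≈⟨ +-cong (reflexive (≡.cong₂ (λ m q → H (suc m) * (w (true ∷ ⊥) * q)) (length-map _ σ) (prod-map-map w _ σ)))
                  (sumL-insertions H w σ) ⟩
      H (suc (length σ)) * (w (true ∷ ⊥) * q) + H (length σ) * d
        ≈⟨ solve 4 (λ h a q e → h :* (a :* q) :+ e := e :+ a :* h :* q) refl
                 (H (suc (length σ))) (w (true ∷ ⊥)) q (H (length σ) * d) ⟩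
      H (length σ) * d + w (true ∷ ⊥) * H (suc (length σ)) * q ∎
      where
      q = prod (map (w ∘ (false ∷_)) σ)
      d = prod′ (w ∘ (false ∷_)) (w ∘ (true ∷_)) σ

-- R[ε]/(ε²), with a + ε b represented as (a , b).
DualNumbers : ∀ {c ℓ} → CommutativeRing c ℓ → CommutativeRing c ℓ
DualNumbers R = record
  { Carrier = Carrier × Carrier
  ; _≈_ = λ (a , b) (a′ , b′) → a ≈ a′ × b ≈ b′
  ; _+_ = λ (a , b) (a′ , b′) → a + a′ , b + b′
  ; _*_ = _⊛_
  ; -_ = λ (a , b) → - a , - b
  ; 0# = 0# , 0#
  ; 1# = 1# , 0#
  ; isCommutativeRing = record
    { isRing = record
      { +-isAbelianGroup = record
        { isGroup = record
          { isMonoid = record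
            { isSemigroup = record
              { isMagma = record
                { isEquivalence = record
                  { refl = refl , refl
                  ; sym = λ (p , q) → sym p , sym q
                  ; trans = λ (p , q) (p′ , q′) → trans p p′ , trans q q′ }
                ; ∙-cong = λ (p , q) (p′ , q′) → +-cong p p′ , +-cong q q′ }
              ; assoc = λ _ _ _ → +-assoc _ _ _ , +-assoc _ _ _ }
            ; identity = (λ _ → +-identityˡ _ , +-identityˡ _) , (λ _ → +-identityʳ _ , +-identityʳ _) }
          ; inverse = (λ _ → -‿inverseˡ _ , -‿inverseˡ _) , (λ _ → -‿inverseʳ _ , -‿inverseʳ _)
          ; ⁻¹-cong = λ (p , q) → -‿cong p , -‿cong q }
        ; comm = λ _ _ → +-comm _ _ , +-comm _ _ }
      ; *-cong = λ (p , q) (p′ , q′) → *-cong p p′ , +-cong (*-cong p q′) (*-cong q p′)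
      ; *-assoc = λ (a , b) (a′ , b′) (a″ , b″) → *-assoc a a′ a″ ,
          solve 6 (λ a b a′ b′ a″ b″ → a :* a′ :* b″ :+ (a :* b′ :+ b :* a′) :* a″
                                    := a :* (a′ :* b″ :+ b′ :* a″) :+ b :* (a′ :* a″)) refl a b a′ b′ a″ b″
      ; *-identity = (λ (a , b) → *-identityˡ a , trans (+-cong (*-identityˡ b) (zeroˡ a)) (+-identityʳ b))
                   , (λ (a , b) → *-identityʳ a , trans (+-cong (zeroʳ a) (*-identityʳ b)) (+-identityˡ b))
      ; distrib = (λ (a , b) (a′ , b′) (a″ , b″) → distribˡ a a′ a″ ,
                     solve 6 (λ a b a′ b′ a″ b″ → a :* (b′ :+ b″) :+ b :* (a′ :+ a″)
                                              := (a :* b′ :+ b :* a′) :+ (a :* b″ :+ b :* a″)) refl a b a′ b′ a″ b″)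
                , (λ (a , b) (a′ , b′) (a″ , b″) → distribʳ a a′ a″ ,
                     solve 6 (λ a b a′ b′ a″ b″ → (a′ :+ a″) :* b :+ (b′ :+ b″) :* a
                                              := (a′ :* b :+ b′ :* a) :+ (a″ :* b :+ b″ :* a)) refl a b a′ b′ a″ b″) }
    ; *-comm = λ (a , b) (a′ , b′) → *-comm a a′ ,
        solve 4 (λ a b a′ b′ → a :* b′ :+ b :* a′ := a′ :* b :+ b′ :* a) refl a b a′ b′ } }
  where
  open CommutativeRing R
  open import Algebra.Solver.Ring.NaturalCoefficients.Default commutativeSemiring using (solve; _:=_; _:+_; _:*_)
  _⊛_ : Carrier × Carrier → Carrier × Carrier → Carrier × Carrier
  (a , b) ⊛ (a′ , b′) = a * a′ , a * b′ + b * a′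

module _ {c₁ ℓ₁ c₂ ℓ₂ : Level} {R₁ : CommutativeRing c₁ ℓ₁} {R₂ : CommutativeRing c₂ ℓ₂}
         {φ : CommutativeRing.Carrier R₁ → CommutativeRing.Carrier R₂}
         (φ-isHom : IsRingHomomorphism (CommutativeRing.rawRing R₁) (CommutativeRing.rawRing R₂) φ)
         where
  private
    module R₁ = CommutativeRing R₁
    module R₂ = CommutativeRing R₂
    module Σ₁ = PartitionSums R₁
    module Σ₂ = PartitionSums R₂
    module C₁ = Cumulants R₁
    module C₂ = Cumulants R₂
  open IsRingHomomorphism φ-isHom
  open R₂ using (_≈_; trans; +-cong; *-cong)

  partitionSum-homo : ∀ {n} (H : ℕ → R₁.Carrier) (w : Subset n → R₁.Carrier) I →
    φ (Σ₁.partitionSum H w I) ≈ Σ₂.partitionSum (φ ∘ H) (φ ∘ w) I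
  partitionSum-homo H w I = trans (sumL-homo (λ π → H (length π) R₁.* C₁.prod (map w π)) (setPartitions I))
    (Σ₂.sumL-cong (λ π → trans (*-homo _ _) (*-cong R₂.refl (prod-homo w π))) (setPartitions I))
    where
    prod-homo : ∀ {a} {A : Set a} (F : A → R₁.Carrier) xs → φ (C₁.prod (map F xs)) ≈ C₂.prod (map (φ ∘ F) xs)
    prod-homo F [] = 1#-homo
    prod-homo F (x ∷ xs) = trans (*-homo _ _) (*-cong R₂.refl (prod-homo F xs))
    sumL-homo : ∀ (F : List (Subset _) → R₁.Carrier) xs → φ (C₁.sumL (map F xs)) ≈ C₂.sumL (map (φ ∘ F) xs)
    sumL-homo F [] = 0#-homo
    sumL-homo F (x ∷ xs) = trans (+-homo _ _) (+-cong R₂.refl (sumL-homo F xs))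

module DualPartitionSums {c ℓ : Level} (R : CommutativeRing c ℓ) where
  open CommutativeRing R
  open Cumulants R using (prod)
  open PartitionSums R
  private
    module D = PartitionSums (DualNumbers R)
    module DC = Cumulants (DualNumbers R)
    module DR = CommutativeRing (DualNumbers R)
    variable
      n : ℕ

  prod-dual : ∀ (w w′ : Subset n → Carrier) σ →
    proj₁ (DC.prod (map (λ B → w B , w′ B) σ)) ≈ prod (map w σ)
      × proj₂ (DC.prod (map (λ B → w B , w′ B) σ)) ≈ prod′ w w′ σ
  prod-dual w w′ [] = refl , refl
  prod-dual w w′ (B ∷ σ) with prod-dual w w′ σ
  ... | p , d = *-cong refl p , +-cong (*-cong refl d) (*-cong refl p)

  partitionSum-ε : ∀ (H H′ : ℕ → Carrier) (w w′ : Subset n → Carrier) X →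
    proj₂ (D.partitionSum (λ m → H m , H′ m) (λ B → w B , w′ B) X) ≈ partitionSum′ H H′ w w′ X
  partitionSum-ε H H′ w w′ X =
    trans (reflexive (proj₂-sumL (setPartitions X)))
      (sumL-cong (λ π → let p , d = prod-dual w w′ π in +-cong (*-cong refl d) (*-cong refl p)) (setPartitions X))
    where
    F : List (Subset _) → Carrier × Carrier
    F π = (H (length π) , H′ (length π)) DR.* DC.prod (map (λ B → w B , w′ B) π)
    proj₂-sumL : ∀ πs → proj₂ (DC.sumL (map F πs)) ≡ Cumulants.sumL R (map (proj₂ ∘ F) πs)
    proj₂-sumL [] = ≡.refl
    proj₂-sumL (π ∷ πs) = ≡.cong (proj₂ (F π) +_) (proj₂-sumL πs)

module _ {c ℓ : Level} (R : CommutativeRing c ℓ) where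
  open CommutativeRing R
  private
    module D² = CommutativeRing (DualNumbers (DualNumbers R))

  swapε : D².Carrier → D².Carrier
  swapε ((a , b) , (a′ , b′)) = (a , a′) , (b , b′)

  swapε-isRingHomomorphism : IsRingHomomorphism D².rawRing D².rawRing swapε
  swapε-isRingHomomorphism = record
    { isSemiringHomomorphism = record
      { isNearSemiringHomomorphism = record
        { +-isMonoidHomomorphism = record
          { isMagmaHomomorphism = record
            { isRelHomomorphism = record { cong = λ ((p , q) , (p′ , q′)) → (p , p′) , (q , q′) }
            ; homo = λ _ _ → D².refl }
          ; ε-homo = D².refl }
        ; *-homo = λ _ _ → (refl , refl) , (refl , interchange _ _ _ _) }
      ; 1#-homo = D².refl }
    ; -‿homo = λ _ → D².refl }
    where open import Algebra.Properties.CommutativeSemigroup +-commutativeSemigroup using (interchange)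

-- Removing an arbitrary element j of I: the recursion of `setPartitions` only peels the first
-- element, so for j = suc j′ the first element is peeled with one infinitesimal and j′ with a
-- second; exchanging the two infinitesimals (a ring automorphism) exchanges the order of peeling.
partitionSum-peel : ∀ {c ℓ n} (R : CommutativeRing c ℓ) (let open CommutativeRing R; open PartitionSums R)
  (H : ℕ → Carrier) (w : Subset n → Carrier) {j I} → j ∈ I →
  partitionSum H w I
    ≈ partitionSum′ H (λ m → w (⊥ [ j ]≔ true) * H (suc m)) w (λ B → w (B [ j ]≔ true)) (I [ j ]≔ false)
partitionSum-peel R H w {I = true ∷ X} here =
  trans (partitionSum-inside H w X)
    (sym (partitionSum′-outside H (λ m → w (true ∷ ⊥) * H (suc m)) w (λ B → w (B [ zero ]≔ true)) X))
  where open CommutativeRing R hiding (zero); open PartitionSums R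
partitionSum-peel R H w {suc j} {false ∷ X} (there j∈X) =
  trans (partitionSum-outside H w X)
    (trans (partitionSum-peel R H (w ∘ (false ∷_)) j∈X)
      (sym (partitionSum′-outside H (λ m → w (⊥ [ suc j ]≔ true) * H (suc m)) w (λ B → w (B [ suc j ]≔ true))
                                  (X [ j ]≔ false))))
  where open CommutativeRing R hiding (zero); open PartitionSums R
partitionSum-peel R H w {suc j} {true ∷ X} (there j∈X) = begin
  partitionSum H w (true ∷ X)
    ≈⟨ partitionSum-inside H w X ⟩
  partitionSum′ H (proj₂ ∘ H₁) (proj₁ ∘ w₁) (proj₂ ∘ w₁) X
    ≈⟨ ε.partitionSum-ε H (proj₂ ∘ H₁) (proj₁ ∘ w₁) (proj₂ ∘ w₁) X ⟨
  proj₂ (D.partitionSum H₁ w₁ X)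
    ≈⟨ proj₂ (partitionSum-peel (DualNumbers R) H₁ w₁ j∈X) ⟩
  proj₂ (D.partitionSum′ H₁ (proj₂ ∘ H₁₂) w₁ (proj₂ ∘ w₁₂) K)
    ≈⟨ proj₂ (εD.partitionSum-ε H₁ (proj₂ ∘ H₁₂) w₁ (proj₂ ∘ w₁₂) K) ⟨
  proj₂ (proj₂ (D².partitionSum H₁₂ w₁₂ K))
    ≈⟨ proj₂ (proj₂ swapped) ⟨
  proj₂ (proj₂ (D².partitionSum H₂₁ w₂₁ K))
    ≈⟨ proj₂ (εD.partitionSum-ε H₂ (proj₂ ∘ H₂₁) (proj₁ ∘ w₂₁) (proj₂ ∘ w₂₁) K) ⟩
  proj₂ (D.partitionSum′ H₂ (proj₂ ∘ H₂₁) (proj₁ ∘ w₂₁) (proj₂ ∘ w₂₁) K)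
    ≈⟨ proj₂ (D.partitionSum-inside H₂ w₂ K) ⟨
  proj₂ (D.partitionSum H₂ w₂ (true ∷ K))
    ≈⟨ ε.partitionSum-ε H (proj₂ ∘ H₂) w (proj₂ ∘ w₂) (true ∷ K) ⟩
  partitionSum′ H (proj₂ ∘ H₂) w (proj₂ ∘ w₂) (true ∷ K) ∎
  where
  open CommutativeRing R
  open PartitionSums R
  open import Relation.Binary.Reasoning.Setoid setoid
  open import Algebra.Properties.CommutativeSemigroup *-commutativeSemigroup using (x∙yz≈y∙xz)
  module D = PartitionSums (DualNumbers R)
  module D² = PartitionSums (DualNumbers (DualNumbers R))
  module DR = CommutativeRing (DualNumbers R)
  module D²R = CommutativeRing (DualNumbers (DualNumbers R))
  module ε = DualPartitionSums R
  module εD = DualPartitionSums (DualNumbers R)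
  K : Subset _
  K = X [ j ]≔ false
  H₁ : ℕ → Carrier × Carrier
  H₁ m = H m , w (true ∷ ⊥) * H (suc m)
  w₁ : Subset _ → Carrier × Carrier
  w₁ B = w (false ∷ B) , w (true ∷ B)
  H₁₂ : ℕ → DR.Carrier × DR.Carrier
  H₁₂ m = H₁ m , w₁ (⊥ [ j ]≔ true) DR.* H₁ (suc m)
  w₁₂ : Subset _ → DR.Carrier × DR.Carrier
  w₁₂ B = w₁ B , w₁ (B [ j ]≔ true)
  H₂ : ℕ → Carrier × Carrier
  H₂ m = H m , w (⊥ [ suc j ]≔ true) * H (suc m)
  w₂ : Subset _ → Carrier × Carrier
  w₂ B = w B , w (B [ suc j ]≔ true)
  H₂₁ : ℕ → DR.Carrier × DR.Carrier
  H₂₁ m = H₂ m , w₂ (true ∷ ⊥) DR.* H₂ (suc m)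
  w₂₁ : Subset _ → DR.Carrier × DR.Carrier
  w₂₁ B = w₂ (false ∷ B) , w₂ (true ∷ B)
  swapped : D².partitionSum H₂₁ w₂₁ K D²R.≈ swapε R (D².partitionSum H₁₂ w₁₂ K)
  swapped = D²R.trans
    (D².partitionSum-cong {H = H₂₁} {H′ = swapε R ∘ H₁₂} {w = w₂₁} {w′ = swapε R ∘ w₁₂}
      (λ m → (refl , refl) , (refl , +-cong (x∙yz≈y∙xz (w (true ∷ ⊥)) (w (⊥ [ suc j ]≔ true)) (H (suc (suc m)))) refl))
      (λ B → D²R.refl) K)
    (D²R.sym (partitionSum-homo {R₁ = DualNumbers (DualNumbers R)} {R₂ = DualNumbers (DualNumbers R)}
                                (swapε-isRingHomomorphism R) H₁₂ w₁₂ K))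

partitionSum-local : ∀ {c ℓ n} (R : CommutativeRing c ℓ) (let open CommutativeRing R; open PartitionSums R)
  (H : ℕ → Carrier) {w w′ : Subset n → Carrier} {j I} →
  (∀ {B} → B [ j ]= false → w B ≈ w′ B) → I [ j ]= false → partitionSum H w I ≈ partitionSum H w′ I
partitionSum-local R H {w} {w′} {I = false ∷ X} w≈w′ here =
  trans (partitionSum-outside H w X)
    (trans (partitionSum-cong {H = H} (λ _ → refl) (λ _ → w≈w′ here) X) (sym (partitionSum-outside H w′ X)))
  where open CommutativeRing R; open PartitionSums R
partitionSum-local R H {w} {w′} {I = false ∷ X} w≈w′ (there j∉X) =
  trans (partitionSum-outside H w X)
    (trans (partitionSum-local R H (w≈w′ ∘ there) j∉X) (sym (partitionSum-outside H w′ X)))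
  where open CommutativeRing R; open PartitionSums R
partitionSum-local R H {w} {w′} {suc j} {true ∷ X} w≈w′ (there j∉X) = begin
  partitionSum H w (true ∷ X)
    ≈⟨ partitionSum-inside H w X ⟩
  partitionSum′ H (proj₂ ∘ H₁) (proj₁ ∘ w₁) (proj₂ ∘ w₁) X
    ≈⟨ ε.partitionSum-ε H (proj₂ ∘ H₁) (proj₁ ∘ w₁) (proj₂ ∘ w₁) X ⟨
  proj₂ (D.partitionSum H₁ w₁ X)
    ≈⟨ proj₂ (D.partitionSum-cong {H = H₁} {H′ = H₁′} {w = w₁} {w′ = w₁}
                (λ m → refl , *-cong (w≈w′ (there (⊥-outside j))) refl) (λ _ → DR.refl) X) ⟩
  proj₂ (D.partitionSum H₁′ w₁ X)
    ≈⟨ proj₂ (partitionSum-local (DualNumbers R) H₁′ (λ B∌j → w≈w′ (there B∌j) , w≈w′ (there B∌j)) j∉X) ⟩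
  proj₂ (D.partitionSum H₁′ w₁′ X)
    ≈⟨ ε.partitionSum-ε H (proj₂ ∘ H₁′) (proj₁ ∘ w₁′) (proj₂ ∘ w₁′) X ⟩
  partitionSum′ H (proj₂ ∘ H₁′) (proj₁ ∘ w₁′) (proj₂ ∘ w₁′) X
    ≈⟨ partitionSum-inside H w′ X ⟨
  partitionSum H w′ (true ∷ X) ∎
  where
  open CommutativeRing R
  open PartitionSums R
  open import Relation.Binary.Reasoning.Setoid setoid
  module D = PartitionSums (DualNumbers R)
  module DR = CommutativeRing (DualNumbers R)
  module ε = DualPartitionSums R
  H₁ H₁′ : ℕ → Carrier × Carrier
  H₁ m = H m , w (true ∷ ⊥) * H (suc m)
  H₁′ m = H m , w′ (true ∷ ⊥) * H (suc m)
  w₁ w₁′ : Subset _ → Carrier × Carrier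
  w₁ B = w (false ∷ B) , w (true ∷ B)
  w₁′ B = w′ (false ∷ B) , w′ (true ∷ B)

module PeeledSums {c ℓ : Level} (R : CommutativeRing c ℓ) where
  open CommutativeRing R
  open Cumulants R using (prod; fromℕ)
  open PartitionSums R
  open import Relation.Binary.Reasoning.Setoid setoid
  open import Algebra.Properties.CommutativeSemigroup +-commutativeSemigroup using (interchange)
  open import Algebra.Properties.CommutativeSemigroup *-commutativeSemigroup using (x∙yz≈y∙xz)
  private
    module D = PartitionSums (DualNumbers R)
    module ε = DualPartitionSums R
    variable
      n : ℕ

  partitionSum′-cong : ∀ {h₀ h₀′ h₁ h₁′ : ℕ → Carrier} {w₀ w₀′ w₁ w₁′ : Subset n → Carrier} →
    (∀ m → h₀ m ≈ h₀′ m) → (∀ m → h₁ m ≈ h₁′ m) → (∀ B → w₀ B ≈ w₀′ B) → (∀ B → w₁ B ≈ w₁′ B) → ∀ K →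
    partitionSum′ h₀ h₁ w₀ w₁ K ≈ partitionSum′ h₀′ h₁′ w₀′ w₁′ K
  partitionSum′-cong {h₀ = h₀} {h₀′} {h₁} {h₁′} {w₀} {w₀′} {w₁} {w₁′} h₀≈ h₁≈ w₀≈ w₁≈ K = begin
    partitionSum′ h₀ h₁ w₀ w₁ K                                    ≈⟨ ε.partitionSum-ε h₀ h₁ w₀ w₁ K ⟨
    proj₂ (D.partitionSum (λ m → h₀ m , h₁ m) (λ B → w₀ B , w₁ B) K)
      ≈⟨ proj₂ (D.partitionSum-cong (λ m → h₀≈ m , h₁≈ m) (λ B → w₀≈ B , w₁≈ B) K) ⟩
    proj₂ (D.partitionSum (λ m → h₀′ m , h₁′ m) (λ B → w₀′ B , w₁′ B) K) ≈⟨ ε.partitionSum-ε h₀′ h₁′ w₀′ w₁′ K ⟩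
    partitionSum′ h₀′ h₁′ w₀′ w₁′ K                                ∎

  partitionSum′-local : ∀ (h₀ h₁ : ℕ → Carrier) {w₀ w₀′ w₁ w₁′ : Subset n → Carrier} {j K} →
    (∀ {B} → B [ j ]= false → w₀ B ≈ w₀′ B) → (∀ {B} → B [ j ]= false → w₁ B ≈ w₁′ B) → K [ j ]= false →
    partitionSum′ h₀ h₁ w₀ w₁ K ≈ partitionSum′ h₀ h₁ w₀′ w₁′ K
  partitionSum′-local h₀ h₁ {w₀} {w₀′} {w₁} {w₁′} {K = K} w₀≈ w₁≈ K∌j = begin
    partitionSum′ h₀ h₁ w₀ w₁ K                                    ≈⟨ ε.partitionSum-ε h₀ h₁ w₀ w₁ K ⟨
    proj₂ (D.partitionSum (λ m → h₀ m , h₁ m) (λ B → w₀ B , w₁ B) K)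
      ≈⟨ proj₂ (partitionSum-local (DualNumbers R) (λ m → h₀ m , h₁ m) (λ B∌j → w₀≈ B∌j , w₁≈ B∌j) K∌j) ⟩
    proj₂ (D.partitionSum (λ m → h₀ m , h₁ m) (λ B → w₀′ B , w₁′ B) K) ≈⟨ ε.partitionSum-ε h₀ h₁ w₀′ w₁′ K ⟩
    partitionSum′ h₀ h₁ w₀′ w₁′ K                                  ∎

  prod′-+ : ∀ (w u v : Subset n → Carrier) σ → prod′ w u σ + prod′ w v σ ≈ prod′ w (λ B → u B + v B) σ
  prod′-+ w u v [] = +-identityʳ 0#
  prod′-+ w u v (B ∷ σ) =
    trans (interchange _ _ _ _)
      (+-cong (trans (sym (distribˡ _ _ _)) (*-cong refl (prod′-+ w u v σ))) (sym (distribʳ _ _ _)))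

  partitionSum′-+ : ∀ (h₀ h₁ h₁′ : ℕ → Carrier) (w₀ w₁ w₁′ : Subset n → Carrier) K →
    partitionSum′ h₀ h₁ w₀ w₁ K + partitionSum′ h₀ h₁′ w₀ w₁′ K
      ≈ partitionSum′ h₀ (λ m → h₁ m + h₁′ m) w₀ (λ B → w₁ B + w₁′ B) K
  partitionSum′-+ h₀ h₁ h₁′ w₀ w₁ w₁′ K = trans (sumL-+ _ _ (setPartitions K)) (sumL-cong merge (setPartitions K))
    where
    merge : ∀ σ → (h₀ (length σ) * prod′ w₀ w₁ σ + h₁ (length σ) * prod (map w₀ σ))
                    + (h₀ (length σ) * prod′ w₀ w₁′ σ + h₁′ (length σ) * prod (map w₀ σ))
                  ≈ h₀ (length σ) * prod′ w₀ (λ B → w₁ B + w₁′ B) σ + (h₁ (length σ) + h₁′ (length σ)) * prod (map w₀ σ)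
    merge σ = trans (interchange _ _ _ _)
      (+-cong (trans (sym (distribˡ _ _ _)) (*-cong refl (prod′-+ w₀ w₁ w₁′ σ))) (sym (distribʳ _ _ _)))

  prod′-diagonal : ∀ (w : Subset n → Carrier) σ → prod′ w w σ ≈ fromℕ (length σ) * prod (map w σ)
  prod′-diagonal w [] = sym (zeroˡ _)
  prod′-diagonal w (B ∷ σ) = begin
    w B * prod′ w w σ + w B * prod (map w σ)               ≈⟨ +-cong (*-cong refl (prod′-diagonal w σ)) refl ⟩
    w B * (fromℕ (length σ) * prod (map w σ)) + w B * prod (map w σ)
      ≈⟨ +-cong (x∙yz≈y∙xz _ _ _) (sym (*-identityˡ _)) ⟩
    fromℕ (length σ) * prod (map w (B ∷ σ)) + 1# * prod (map w (B ∷ σ)) ≈⟨ sym (distribʳ _ _ _) ⟩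
    (fromℕ (length σ) + 1#) * prod (map w (B ∷ σ))          ≈⟨ *-cong (+-comm _ _) refl ⟩
    fromℕ (length (B ∷ σ)) * prod (map w (B ∷ σ))          ∎

module CoefficientSums {c ℓ : Level} (R : CommutativeRing c ℓ) where
  open CommutativeRing R hiding (zero)
  open Cumulants R using (prod; fromℕ; coeff; sign; fact)
  open PartitionSums R
  open PeeledSums R
  open import Relation.Binary.Reasoning.Setoid setoid
  open import Algebra.Properties.CommutativeSemigroup *-commutativeSemigroup using (x∙yz≈y∙xz)
  open import Algebra.Solver.Ring.NaturalCoefficients.Default commutativeSemiring using (solve; _:=_; _:+_; _:*_)
  private
    variable
      n : ℕ

  -- A partition σ of I ∖ {j} with m blocks comes from the partition of I with the extra block
  -- {j} and from the m partitions in which j joins a block of σ.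
  insertionCoeff : ℕ → Carrier
  insertionCoeff m = coeff (suc m) + fromℕ m * coeff m

  insertionCoeff-zero : insertionCoeff 0 ≈ 1#
  insertionCoeff-zero = trans (+-cong (*-identityˡ 1#) (zeroˡ 0#)) (+-identityʳ 1#)

  insertionCoeff-suc : ∀ m → insertionCoeff (suc m) ≈ 0#
  insertionCoeff-suc m = begin
    - sign m * (fromℕ (suc m) * fact m) + fromℕ (suc m) * (sign m * fact m)
      ≈⟨ +-cong (sym (-‿distribˡ-* _ _)) refl ⟩
    - (sign m * (fromℕ (suc m) * fact m)) + fromℕ (suc m) * (sign m * fact m)
      ≈⟨ +-cong (-‿cong (x∙yz≈y∙xz _ _ _)) refl ⟩
    - (fromℕ (suc m) * (sign m * fact m)) + fromℕ (suc m) * (sign m * fact m)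
      ≈⟨ -‿inverseˡ _ ⟩
    0# ∎
    where open import Algebra.Properties.Ring ring using (-‿distribˡ-*)

  partitionSum-complement : ∀ {μ μ′ : Subset n → Carrier} {j I} → μ ⊥ ≈ 1# →
    (∀ {B} → B [ j ]= false → μ′ B ≈ μ B) → (∀ {B} → j ∈ B → μ′ B + μ B ≈ μ (B [ j ]≔ false)) → j ∈ I →
    partitionSum coeff μ′ I + partitionSum coeff μ I ≈ partitionSum insertionCoeff μ (I [ j ]≔ false)
  partitionSum-complement {μ = μ} {μ′} {j} {I} μ⊥≈1 μ′≈μ μ′+μ≈μ j∈I = begin
    partitionSum coeff μ′ I + partitionSum coeff μ I
      ≈⟨ +-cong (partitionSum-peel R coeff μ′ j∈I) (partitionSum-peel R coeff μ j∈I) ⟩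
    partitionSum′ coeff (h μ′) μ′ (μ′ ∘ insert) K + partitionSum′ coeff (h μ) μ (μ ∘ insert) K
      ≈⟨ +-cong (partitionSum′-local coeff (h μ′) μ′≈μ (λ _ → refl) K∌j) refl ⟩
    partitionSum′ coeff (h μ′) μ (μ′ ∘ insert) K + partitionSum′ coeff (h μ) μ (μ ∘ insert) K
      ≈⟨ partitionSum′-+ coeff (h μ′) (h μ) μ (μ′ ∘ insert) (μ ∘ insert) K ⟩
    partitionSum′ coeff (λ m → h μ′ m + h μ m) μ (λ B → μ′ (insert B) + μ (insert B)) K
      ≈⟨ partitionSum′-local coeff (λ m → h μ′ m + h μ m) (λ _ → refl)
           (λ B∌j → trans (μ′+μ≈μ j∈insert) (reflexive (≡.cong μ (remove-insert B∌j)))) K∌j ⟩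
    partitionSum′ coeff (λ m → h μ′ m + h μ m) μ μ K
      ≈⟨ partitionSum′-cong {h₀ = coeff} (λ _ → refl) h-sum (λ _ → refl) (λ _ → refl) K ⟩
    partitionSum′ coeff (coeff ∘ suc) μ μ K
      ≈⟨ sumL-cong collect (setPartitions K) ⟩
    partitionSum insertionCoeff μ K ∎
    where
    K : Subset _
    K = I [ j ]≔ false
    insert : Subset _ → Subset _
    insert B = B [ j ]≔ true
    h : (Subset _ → Carrier) → ℕ → Carrier
    h ν m = ν (⊥ [ j ]≔ true) * coeff (suc m)
    K∌j : K [ j ]= false
    K∌j = []≔-updates I j
    j∈insert : ∀ {B} → j ∈ insert B
    j∈insert {B} = []≔-updates B j
    h-sum : ∀ m → h μ′ m + h μ m ≈ coeff (suc m)
    h-sum m = begin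
      h μ′ m + h μ m                                        ≈⟨ distribʳ _ _ _ ⟨
      (μ′ (insert ⊥) + μ (insert ⊥)) * coeff (suc m)        ≈⟨ *-cong (μ′+μ≈μ j∈insert) refl ⟩
      μ (insert ⊥ [ j ]≔ false) * coeff (suc m)
        ≡⟨ ≡.cong (λ B → μ B * coeff (suc m)) (remove-insert (⊥-outside j)) ⟩
      μ ⊥ * coeff (suc m)                                   ≈⟨ *-cong μ⊥≈1 refl ⟩
      1# * coeff (suc m)                                    ≈⟨ *-identityˡ _ ⟩
      coeff (suc m)                                         ∎
    collect : ∀ σ → coeff (length σ) * prod′ μ μ σ + coeff (suc (length σ)) * prod (map μ σ)
                    ≈ insertionCoeff (length σ) * prod (map μ σ)
    collect σ = begin
      coeff (length σ) * prod′ μ μ σ + coeff (suc (length σ)) * prod (map μ σ)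
        ≈⟨ +-cong (*-cong refl (prod′-diagonal μ σ)) refl ⟩
      coeff (length σ) * (fromℕ (length σ) * prod (map μ σ)) + coeff (suc (length σ)) * prod (map μ σ)
        ≈⟨ solve 4 (λ c n q c′ → c :* (n :* q) :+ c′ :* q := (c′ :+ n :* c) :* q) refl
                 (coeff (length σ)) (fromℕ (length σ)) (prod (map μ σ)) (coeff (suc (length σ))) ⟩
      insertionCoeff (length σ) * prod (map μ σ) ∎

  partitionSum-⊥ : ∀ (e : ℕ → Carrier) (w : Subset n → Carrier) → partitionSum e w ⊥ ≈ e 0
  partitionSum-⊥ {zero} e w = trans (+-identityʳ _) (*-identityʳ _)
  partitionSum-⊥ {suc n} e w = trans (partitionSum-outside e w ⊥) (partitionSum-⊥ e (w ∘ (false ∷_)))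

  -- Every partition of a nonempty set has at least one block.
  partitionSum-nonempty : ∀ (e : ℕ → Carrier) (w : Subset n → Carrier) → (∀ m → e (suc m) ≈ 0#) →
    ∀ {K} → Nonempty K → partitionSum e w K ≈ 0#
  partitionSum-nonempty e w e≈0 {true ∷ X} _ =
    trans (partitionSum-inside e w X) (sumL-zero vanish (setPartitions X))
    where
    first : ∀ σ → e (length σ) * prod′ (w ∘ (false ∷_)) (w ∘ (true ∷_)) σ ≈ 0#
    first [] = zeroʳ _
    first (B ∷ σ) = trans (*-cong (e≈0 _) refl) (zeroˡ _)
    vanish : ∀ σ → e (length σ) * prod′ (w ∘ (false ∷_)) (w ∘ (true ∷_)) σ
                   + w (true ∷ ⊥) * e (suc (length σ)) * prod (map (w ∘ (false ∷_)) σ) ≈ 0#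
    vanish σ = trans (+-cong (first σ) (trans (*-cong (trans (*-cong refl (e≈0 _)) (zeroʳ _)) refl) (zeroˡ _)))
                     (+-identityʳ 0#)
  partitionSum-nonempty e w e≈0 {false ∷ X} (suc i , there i∈X) =
    trans (partitionSum-outside e w X) (partitionSum-nonempty e (w ∘ (false ∷_)) e≈0 (i , i∈X))

module Moments {c ℓ : Level} (R : CommutativeRing c ℓ) where
  open CommutativeRing R hiding (zero)
  open Cumulants R using (sumSubsets; moment; ρ)
  open import Relation.Binary.Reasoning.Setoid setoid
  open import Algebra.Properties.CommutativeSemigroup +-commutativeSemigroup using (interchange)
  private
    variable
      n : ℕ

  sumSubsets-cong : ∀ {f g : Subset n → Carrier} → (∀ K → f K ≈ g K) → sumSubsets f ≈ sumSubsets g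
  sumSubsets-cong {zero} f≈g = f≈g []
  sumSubsets-cong {suc n} f≈g = +-cong (sumSubsets-cong (f≈g ∘ (false ∷_))) (sumSubsets-cong (f≈g ∘ (true ∷_)))

  sumSubsets-+ : ∀ (f g : Subset n → Carrier) → sumSubsets (λ K → f K + g K) ≈ sumSubsets f + sumSubsets g
  sumSubsets-+ {zero} f g = refl
  sumSubsets-+ {suc n} f g =
    trans (+-cong (sumSubsets-+ (f ∘ (false ∷_)) (g ∘ (false ∷_))) (sumSubsets-+ (f ∘ (true ∷_)) (g ∘ (true ∷_))))
          (interchange _ _ _ _)

  sumSubsets-zero : sumSubsets {n} (λ _ → 0#) ≈ 0#
  sumSubsets-zero {zero} = refl
  sumSubsets-zero {suc n} = trans (+-cong (sumSubsets-zero {n}) (sumSubsets-zero {n})) (+-identityʳ 0#)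

  sumSubsets-ρ : ∀ (J : Subset n) (p : Subset n → Carrier) → sumSubsets (ρ J p) ≈ sumSubsets p
  sumSubsets-ρ [] p = refl
  sumSubsets-ρ (false ∷ J) p = +-cong (sumSubsets-ρ J (p ∘ (false ∷_))) (sumSubsets-ρ J (p ∘ (true ∷_)))
  sumSubsets-ρ (true ∷ J) p =
    trans (+-cong (sumSubsets-ρ J (p ∘ (true ∷_))) (sumSubsets-ρ J (p ∘ (false ∷_)))) (+-comm _ _)

  marginal : (Subset (suc n) → Carrier) → Subset n → Carrier
  marginal p K = p (false ∷ K) + p (true ∷ K)

  moment-cong : ∀ {p q : Subset n → Carrier} → (∀ K → p K ≈ q K) → ∀ B → moment p B ≈ moment q B
  moment-cong p≈q B = sumSubsets-cong (λ K → if-cong (does (B ⊆? K)) (p≈q K))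
    where
    if-cong : ∀ b {x y} → x ≈ y → (if b then x else 0#) ≈ (if b then y else 0#)
    if-cong true x≈y = x≈y
    if-cong false _ = refl

  moment-+ : ∀ (p q : Subset n → Carrier) B → moment (λ K → p K + q K) B ≈ moment p B + moment q B
  moment-+ p q B = trans (sumSubsets-cong (λ K → if-+ (does (B ⊆? K))))
    (sumSubsets-+ (λ K → if does (B ⊆? K) then p K else 0#) (λ K → if does (B ⊆? K) then q K else 0#))
    where
    if-+ : ∀ b {x y} → (if b then x + y else 0#) ≈ (if b then x else 0#) + (if b then y else 0#)
    if-+ true = refl
    if-+ false = sym (+-identityʳ 0#)

  moment-outside : ∀ (p : Subset (suc n) → Carrier) B → moment p (false ∷ B) ≈ moment (marginal p) B
  moment-outside p B = sym (moment-+ (p ∘ (false ∷_)) (p ∘ (true ∷_)) B)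

  moment-inside : ∀ (p : Subset (suc n) → Carrier) B → moment p (true ∷ B) ≈ moment (p ∘ (true ∷_)) B
  moment-inside {n} p B = trans (+-cong (sumSubsets-zero {n}) refl) (+-identityˡ _)

  moment-⊥ : ∀ (p : Subset n → Carrier) → moment p ⊥ ≈ sumSubsets p
  moment-⊥ p = sumSubsets-cong (λ K → reflexive (≡.cong (if_then p K else 0#) (dec-true (⊥ ⊆? K) ⊥⊆)))

  moment-ρ-outside : ∀ (p : Subset n → Carrier) {j B} → B [ j ]= false → moment (ρ ⁅ j ⁆ p) B ≈ moment p B
  moment-ρ-outside p {B = false ∷ B} here = begin
    moment (ρ ⁅ zero ⁆ p) (false ∷ B)                  ≈⟨ moment-outside (ρ ⁅ zero ⁆ p) B ⟩
    moment (marginal (ρ ⁅ zero ⁆ p)) B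
      ≈⟨ moment-cong (λ K → trans (+-comm _ _) (reflexive (≡.cong₂ (λ X Y → p (false ∷ X) + p (true ∷ Y))
                                                       (Δ-identityʳ K) (Δ-identityʳ K)))) B ⟩
    moment (marginal p) B                              ≈⟨ moment-outside p B ⟨
    moment p (false ∷ B)                               ∎
  moment-ρ-outside p {suc j} {false ∷ B} (there B∌j) =
    trans (moment-outside (ρ ⁅ suc j ⁆ p) B) (trans (moment-ρ-outside (marginal p) B∌j) (sym (moment-outside p B)))
  moment-ρ-outside p {suc j} {true ∷ B} (there B∌j) =
    trans (moment-inside (ρ ⁅ suc j ⁆ p) B) (trans (moment-ρ-outside (p ∘ (true ∷_)) B∌j) (sym (moment-inside p B)))

  moment-ρ-inside : ∀ (p : Subset n → Carrier) {j B} → j ∈ B →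
    moment (ρ ⁅ j ⁆ p) B + moment p B ≈ moment p (B [ j ]≔ false)
  moment-ρ-inside p {B = true ∷ B} here = begin
    moment (ρ ⁅ zero ⁆ p) (true ∷ B) + moment p (true ∷ B)
      ≈⟨ +-cong (moment-inside (ρ ⁅ zero ⁆ p) B) (moment-inside p B) ⟩
    moment (ρ ⁅ zero ⁆ p ∘ (true ∷_)) B + moment (p ∘ (true ∷_)) B
      ≈⟨ +-cong (moment-cong (λ K → reflexive (≡.cong (λ X → p (false ∷ X)) (Δ-identityʳ K))) B) refl ⟩
    moment (p ∘ (false ∷_)) B + moment (p ∘ (true ∷_)) B
      ≡⟨⟩
    moment p (false ∷ B) ∎
  moment-ρ-inside p {suc j} {false ∷ B} (there j∈B) =
    trans (+-cong (moment-outside (ρ ⁅ suc j ⁆ p) B) (moment-outside p B))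
      (trans (moment-ρ-inside (marginal p) j∈B) (sym (moment-outside p (B [ j ]≔ false))))
  moment-ρ-inside p {suc j} {true ∷ B} (there j∈B) =
    trans (+-cong (moment-inside (ρ ⁅ suc j ⁆ p) B) (moment-inside p B))
      (trans (moment-ρ-inside (p ∘ (true ∷_)) j∈B) (sym (moment-inside p (B [ j ]≔ false))))

module CumulantSymmetries {c ℓ : Level} (R : CommutativeRing c ℓ) where
  open CommutativeRing R hiding (zero)
  open Cumulants R
  open PartitionSums R using (partitionSum; partitionSum-cong)
  open CoefficientSums R
  open Moments R
  open import Algebra.Properties.Group +-group using (inverseˡ-unique; //-rightDividesʳ)
  open import Algebra.Properties.Ring ring using (-‿involutive)
  open import Algebra.Properties.AbelianGroup +-abelianGroup using (⁻¹-∙-comm)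
  open import Relation.Binary.Reasoning.Setoid setoid
  private
    variable
      n : ℕ

  cumulant-cong : ∀ {p q : Subset n → Carrier} → (∀ K → p K ≈ q K) → ∀ I → cumulant p I ≈ cumulant q I
  cumulant-cong p≈q = partitionSum-cong {H = coeff} (λ _ → refl) (moment-cong p≈q)

  cumulant-ρ-outside : ∀ (p : Subset n → Carrier) {j I} → I [ j ]= false → cumulant (ρ ⁅ j ⁆ p) I ≈ cumulant p I
  cumulant-ρ-outside p = partitionSum-local R coeff (moment-ρ-outside p)

  cumulant-ρ-inside : ∀ (p : Subset n → Carrier) → sumSubsets p ≈ 1# → ∀ {j I} → j ∈ I →
    cumulant (ρ ⁅ j ⁆ p) I + cumulant p I ≈ partitionSum insertionCoeff (moment p) (I [ j ]≔ false)
  cumulant-ρ-inside p p≈1 =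
    partitionSum-complement (trans (moment-⊥ p) p≈1) (moment-ρ-outside p) (moment-ρ-inside p)

  negateIf : Bool → Carrier → Carrier
  negateIf b x = if b then - x else x

  complementIf : Bool → Carrier → Carrier
  complementIf b x = if b then 1# - x else x

  cumulant-ρ-⁅⁆ : ∀ (p : Subset n → Carrier) → sumSubsets p ≈ 1# → ∀ {I} → 2 ≤ ∣ I ∣ → ∀ j →
    cumulant (ρ ⁅ j ⁆ p) I ≈ negateIf (isOdd (⁅ j ⁆ ∩ I)) (cumulant p I)
  cumulant-ρ-⁅⁆ p p≈1 {I} 2≤∣I∣ j
    rewrite isOdd-⁅⁆-∩ j I with lookup I j in I[j]
  ... | false = cumulant-ρ-outside p (lookup⇒[]= j I I[j])
  ... | true = inverseˡ-unique _ _ (trans (cumulant-ρ-inside p p≈1 (lookup⇒[]= j I I[j]))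
      (partitionSum-nonempty insertionCoeff (moment p) insertionCoeff-suc (remove-nonempty I j 2≤∣I∣)))

  cumulant-⁅i⁆-ρ-⁅⁆ : ∀ (p : Subset n → Carrier) → sumSubsets p ≈ 1# → ∀ i j →
    cumulant (ρ ⁅ j ⁆ p) ⁅ i ⁆ ≈ complementIf (isOdd (⁅ j ⁆ ∩ ⁅ i ⁆)) (cumulant p ⁅ i ⁆)
  cumulant-⁅i⁆-ρ-⁅⁆ p p≈1 i j
    rewrite isOdd-⁅⁆-∩ j ⁅ i ⁆ with lookup ⁅ i ⁆ j in ⁅i⁆[j]
  ... | false = cumulant-ρ-outside p (lookup⇒[]= j ⁅ i ⁆ ⁅i⁆[j])
  ... | true with ≡.refl ← x∈⁅y⁆⇒x≡y i (lookup⇒[]= j ⁅ i ⁆ ⁅i⁆[j]) = begin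
    cumulant (ρ ⁅ i ⁆ p) ⁅ i ⁆                                 ≈⟨ //-rightDividesʳ (cumulant p ⁅ i ⁆) _ ⟨
    cumulant (ρ ⁅ i ⁆ p) ⁅ i ⁆ + cumulant p ⁅ i ⁆ - cumulant p ⁅ i ⁆
      ≈⟨ +-cong (cumulant-ρ-inside p p≈1 (x∈⁅x⁆ i)) refl ⟩
    partitionSum insertionCoeff (moment p) (⁅ i ⁆ [ i ]≔ false) - cumulant p ⁅ i ⁆
      ≡⟨ ≡.cong (λ K → partitionSum insertionCoeff (moment p) K - cumulant p ⁅ i ⁆) (⁅i⁆-remove-i i) ⟩
    partitionSum insertionCoeff (moment p) ⊥ - cumulant p ⁅ i ⁆
      ≈⟨ +-cong (trans (partitionSum-⊥ insertionCoeff (moment p)) insertionCoeff-zero) refl ⟩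
    1# - cumulant p ⁅ i ⁆                                      ∎

  module _ (T : Bool → Carrier → Carrier) (T-cong : ∀ b {x y} → x ≈ y → T b x ≈ T b y)
           (T-false : ∀ x → T false x ≈ x) (T-xor : ∀ a b x → T a (T b x) ≈ T (a xor b) x) where

    cumulant-ρ-from-⁅⁆ : ∀ (I : Subset n) →
      (∀ (p : Subset n → Carrier) → sumSubsets p ≈ 1# → ∀ j →
         cumulant (ρ ⁅ j ⁆ p) I ≈ T (isOdd (⁅ j ⁆ ∩ I)) (cumulant p I)) →
      ∀ J (p : Subset n → Carrier) → sumSubsets p ≈ 1# → cumulant (ρ J p) I ≈ T (isOdd (J ∩ I)) (cumulant p I)
    cumulant-ρ-from-⁅⁆ I single = Δ-induction _ base step
      where
      base : ∀ p → sumSubsets p ≈ 1# → cumulant (ρ ⊥ p) I ≈ T (isOdd (⊥ ∩ I)) (cumulant p I)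
      base p _ = begin
        cumulant (ρ ⊥ p) I                 ≈⟨ cumulant-cong (λ K → reflexive (≡.cong p (Δ-identityʳ K))) I ⟩
        cumulant p I                       ≈⟨ T-false _ ⟨
        T false (cumulant p I)             ≡⟨ ≡.cong (λ b → T b (cumulant p I)) (isOdd-⊥-∩ I) ⟨
        T (isOdd (⊥ ∩ I)) (cumulant p I)   ∎
      step : ∀ A j → (∀ p → sumSubsets p ≈ 1# → cumulant (ρ A p) I ≈ T (isOdd (A ∩ I)) (cumulant p I)) →
        ∀ p → sumSubsets p ≈ 1# → cumulant (ρ (A Δ ⁅ j ⁆) p) I ≈ T (isOdd ((A Δ ⁅ j ⁆) ∩ I)) (cumulant p I)
      step A j hyp p p≈1 = begin
        cumulant (ρ (A Δ ⁅ j ⁆) p) I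
          ≈⟨ cumulant-cong (λ K → reflexive (≡.cong p (Δ-assoc K A ⁅ j ⁆))) I ⟨
        cumulant (ρ A (ρ ⁅ j ⁆ p)) I
          ≈⟨ hyp (ρ ⁅ j ⁆ p) (trans (sumSubsets-ρ ⁅ j ⁆ p) p≈1) ⟩
        T (isOdd (A ∩ I)) (cumulant (ρ ⁅ j ⁆ p) I)
          ≈⟨ T-cong (isOdd (A ∩ I)) (single p p≈1 j) ⟩
        T (isOdd (A ∩ I)) (T (isOdd (⁅ j ⁆ ∩ I)) (cumulant p I))
          ≈⟨ T-xor _ _ _ ⟩
        T (isOdd (A ∩ I) xor isOdd (⁅ j ⁆ ∩ I)) (cumulant p I)
          ≡⟨ ≡.cong (λ b → T b (cumulant p I)) (isOdd-Δ-∩ A ⁅ j ⁆ I) ⟨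
        T (isOdd ((A Δ ⁅ j ⁆) ∩ I)) (cumulant p I) ∎

  negateIf-xor : ∀ a b x → negateIf a (negateIf b x) ≈ negateIf (a xor b) x
  negateIf-xor true true x = -‿involutive x
  negateIf-xor true false x = refl
  negateIf-xor false b x = refl

  complementIf-xor : ∀ a b x → complementIf a (complementIf b x) ≈ complementIf (a xor b) x
  complementIf-xor true true x = begin
    1# - (1# - x)          ≈⟨ +-cong refl (⁻¹-∙-comm 1# (- x)) ⟨
    1# + (- 1# + - - x)    ≈⟨ +-assoc _ _ _ ⟨
    1# - 1# + - - x        ≈⟨ +-cong (-‿inverseʳ 1#) (-‿involutive x) ⟩
    0# + x                 ≈⟨ +-identityˡ x ⟩
    x                      ∎
  complementIf-xor true false x = refl
  complementIf-xor false b x = refl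

  cumulant-ρ : ∀ (p : Subset n → Carrier) → sumSubsets p ≈ 1# → ∀ {I} → 2 ≤ ∣ I ∣ → ∀ J →
    cumulant (ρ J p) I ≈ negateIf (isOdd (J ∩ I)) (cumulant p I)
  cumulant-ρ p p≈1 {I} 2≤∣I∣ J =
    cumulant-ρ-from-⁅⁆ negateIf (λ { true → -‿cong ; false → λ x≈y → x≈y }) (λ _ → refl) negateIf-xor
      I (λ q q≈1 → cumulant-ρ-⁅⁆ q q≈1 2≤∣I∣) J p p≈1

  cumulant-⁅i⁆-ρ : ∀ (p : Subset n → Carrier) → sumSubsets p ≈ 1# → ∀ i J →
    cumulant (ρ J p) ⁅ i ⁆ ≈ complementIf (isOdd (J ∩ ⁅ i ⁆)) (cumulant p ⁅ i ⁆)
  cumulant-⁅i⁆-ρ p p≈1 i J =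
    cumulant-ρ-from-⁅⁆ complementIf (λ { true → λ x≈y → +-cong refl (-‿cong x≈y) ; false → λ x≈y → x≈y })
      (λ _ → refl) complementIf-xor ⁅ i ⁆ (λ q q≈1 → cumulant-⁅i⁆-ρ-⁅⁆ q q≈1 i) J p p≈1

corollary3p6 : ∀ {c ℓ : Level} (R : CommutativeRing c ℓ) (n : ℕ)
    (p : Subset n → CommutativeRing.Carrier R) →
    let open CommutativeRing R
        open Cumulants R
    in sumSubsets p ≈ 1# →
       ((I J : Subset n) → 2 ≤ ∣ I ∣ →
          (∣ J ∩ I ∣ % 2 ≡ 1 → cumulant (ρ J p) I ≈ - cumulant p I)
          × (¬ (∣ J ∩ I ∣ % 2 ≡ 1) → cumulant (ρ J p) I ≈ cumulant p I))
       × ((i : Fin n) (J : Subset n) →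
          (i ∈ J → cumulant (ρ J p) ⁅ i ⁆ ≈ 1# - cumulant p ⁅ i ⁆)
          × (i ∉ J → cumulant (ρ J p) ⁅ i ⁆ ≈ cumulant p ⁅ i ⁆))
corollary3p6 R n p p≈1 =
    (λ I J 2≤∣I∣ → byParity (isOdd (J ∩ I)) (∣p∣%2≡isOdd (J ∩ I)) (cumulant-ρ p p≈1 2≤∣I∣ J))
  , (λ i J → byMembership (isOdd (J ∩ ⁅ i ⁆)) (isOdd-∩-⁅⁆ J i) (cumulant-⁅i⁆-ρ p p≈1 i J))
  where
  open CommutativeRing R
  open CumulantSymmetries R
  byParity : ∀ b {m x k} → m ≡ (if b then 1 else 0) → x ≈ negateIf b k → (m ≡ 1 → x ≈ - k) × (¬ m ≡ 1 → x ≈ k)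
  byParity true m≡1 x≈-k = (λ _ → x≈-k) , (λ m≢1 → contradiction m≡1 m≢1)
  byParity false ≡.refl x≈k = (λ ()) , (λ _ → x≈k)
  byMembership : ∀ {J : Subset n} {i} b → b ≡ lookup J i → ∀ {x k} → x ≈ complementIf b k →
    (i ∈ J → x ≈ 1# - k) × (i ∉ J → x ≈ k)
  byMembership {J} {i} true J[i] x≈1-k = (λ _ → x≈1-k) , (λ i∉J → contradiction (lookup⇒[]= i J (≡.sym J[i])) i∉J)
  byMembership false J[i] x≈k = (λ i∈J → contradiction (≡.trans J[i] ([]=⇒lookup i∈J)) (λ ())) , (λ _ → x≈k)
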